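{- Let $k\ge1$ and suppose there is an integer $p$ such that every $k$-transitive tournament $T$ satisfies $dom(T)\le p$ (i.e. $p(k)$ exists and $p(k)\le p$). Then every tournament $T$ with a transitive edge coloring with colors $1,\dots,k$ satisfies $encl(T)\le 2^k p$; that is, $r(k)\le 2^k p(k)$.
   Context: An edge coloring of a tournament $T$ with colors $1,\dots,k$ is transitive if for each $i$ the digraph $T(i)$ of edges of color $i$ is transitive (whenever $ab,bc\in E(T(i))$, also $ac\in E(T(i))$); $T$ is $k$-transitive if it has such a coloring. $dom(T)$ is the minimum size of a set $S$ of vertices such that every $v\notin S$ has some $w\in S$ with $wv\in E(T)$. $p(k)$ is the least integer bounding $dom(T)$ for all $k$-transitive $T$ (if it exists). For a transitively $k$-colored $T$, $S\subseteq V(T)$ is an enclosure set if for every $b\notin S$ there exist a color $i$ and $a,c\in S$ with $ab,bc\in E(T(i))$; $encl(T)$ is the minimum size of an enclosure set, and $r(k)$ is the supremum of $encl(T)$ over all transitively $k$-colored tournaments. -}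

module Defs where

open import Data.Nat using (ℕ)
open import Data.Fin using (Fin)
open import Data.Bool using (Bool; true; false)
open import Data.List using (List; length)
open import Data.List.Membership.Propositional using (_∈_; _∉_)
open import Data.Product using (Σ; _×_; ∃; ∃-syntax; _,_)
open import Data.Sum using (_⊎_)
open import Relation.Binary.PropositionalEquality using (_≡_; _≢_)
open import Relation.Nullary using (¬_)

record Tournament (n : ℕ) : Set where
  field
    Edge      : Fin n → Fin n → Bool
    irrefl    : ∀ a → Edge a a ≡ false
    complete  : ∀ a b → a ≢ b → (Edge a b ≡ true) ⊎ (Edge b a ≡ true)
    antisym   : ∀ a b → Edge a b ≡ true → Edge b a ≡ false

open Tournament public

_⇒[_]_ : ∀ {n} → Fin n → Tournament n → Fin n → Set
a ⇒[ T ] b = Edge T a b ≡ true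

-- An edge colouring with colours Fin k (colours 1..k); only its values on edges matter.
Colouring : ℕ → ℕ → Set
Colouring n k = Fin n → Fin n → Fin k

ColEdge : ∀ {n k} → Tournament n → Colouring n k → Fin k → Fin n → Fin n → Set
ColEdge T c i a b = (a ⇒[ T ] b) × (c a b ≡ i)

IsTransitiveColouring : ∀ {n k} → Tournament n → Colouring n k → Set
IsTransitiveColouring {n} {k} T c =
  ∀ (i : Fin k) (a b d : Fin n) → ColEdge T c i a b → ColEdge T c i b d → ColEdge T c i a d

KTransitive : ∀ {n} → ℕ → Tournament n → Set
KTransitive {n} k T = Σ (Colouring n k) λ c → IsTransitiveColouring T c

-- S (a list of vertices; its size is at most its length) is dominating
IsDominating : ∀ {n} → Tournament n → List (Fin n) → Set
IsDominating {n} T S = ∀ (v : Fin n) → v ∉ S → ∃[ w ] (w ∈ S × (w ⇒[ T ] v))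

DomAtMost : ∀ {n} → Tournament n → ℕ → Set
DomAtMost T m = ∃[ S ] (IsDominating T S × length S Data.Nat.≤ m)

IsEnclosure : ∀ {n k} → Tournament n → Colouring n k → List (Fin n) → Set
IsEnclosure {n} {k} T c S =
  ∀ (b : Fin n) → b ∉ S →
    ∃[ i ] ∃[ a ] ∃[ d ] (a ∈ S × d ∈ S × ColEdge T c i a b × ColEdge T c i b d)

EnclAtMost : ∀ {n k} → Tournament n → Colouring n k → ℕ → Set
EnclAtMost T c m = ∃[ S ] (IsEnclosure T c S × length S Data.Nat.≤ m)

module Submission where

open import Defs
open import Data.Nat using (ℕ; _≥_; _*_; _^_; _≤_)
open import Data.Nat.Properties using (≤-refl; ≤-reflexive; ≤-trans; +-mono-≤)
open import Data.Fin using (Fin; finToFun; funToFin) renaming (_≟_ to _≟ᶠ_)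
open import Data.Fin.Properties using (2↔Bool; finToFun-funToFin)
open import Data.Bool using (Bool; true; false; _∧_; _∨_; not; if_then_else_) renaming (_≟_ to _≟ᵇ_)
open import Data.List using (List; []; _∷_; length; concatMap; allFin)
open import Data.List.Properties using (length-++; length-tabulate)
open import Data.List.Membership.Propositional using (_∈_; find; lose)
open import Data.List.Membership.Propositional.Properties using (∈-concatMap⁺; ∈-allFin)
open import Data.List.Relation.Unary.Any using (Any; any?)
open import Data.Product using (_×_; ∃-syntax; _,_; proj₁; proj₂)
open import Data.Sum using (_⊎_; inj₁; inj₂)
open import Data.Empty using (⊥-elim)
open import Function using (_∘_; id; Inverse)
open import Relation.Binary.PropositionalEquality using (_≡_; _≗_; refl; sym; trans; cong; subst)
open import Relation.Nullary using (Dec; does; proof; Reflects; ofʸ; ofⁿ; _×-dec_)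

-- For each set R of colours, reversing all edges whose colour lies in R keeps the colouring
-- transitive, so the reversed tournament has a dominating set S_R of size at most p; let S be
-- the union of all 2^k of them. Given b ∉ S, choose R to be the set of colours i such that
-- some vertex of S sends an i-edge into b. A vertex w ∈ S_R dominating b in the reversal of R
-- reaches b by an edge of some colour i. If i ∉ R, then wb is an i-edge of T with w ∈ S,
-- contradicting the choice of R; so i ∈ R, bw is an i-edge of T, and some a ∈ S sends an
-- i-edge into b: the pair a, w encloses b.

module Reversal {n k} (T : Tournament n) (c : Colouring n k) (R : Fin k → Bool) where

  reversedEdge : Fin n → Fin n → Bool
  reversedEdge a b = (Edge T a b ∧ not (R (c a b))) ∨ (Edge T b a ∧ R (c b a))

  reversed-irrefl : ∀ a → reversedEdge a a ≡ false
  reversed-irrefl a rewrite irrefl T a = refl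

  reversed-complete : ∀ a b → (Edge T a b ≡ true) ⊎ (Edge T b a ≡ true) →
                      (reversedEdge a b ≡ true) ⊎ (reversedEdge b a ≡ true)
  reversed-complete a b e with Edge T a b | Edge T b a | R (c a b) | R (c b a)
  ... | true  | _     | false | _     = inj₁ refl
  ... | true  | false | true  | _     = inj₂ refl
  ... | true  | true  | true  | false = inj₂ refl
  ... | true  | true  | true  | true  = inj₁ refl
  ... | false | true  | _     | true  = inj₁ refl
  ... | false | true  | _     | false = inj₂ refl
  ... | false | false | _     | _     with e
  ...   | inj₁ ()
  ...   | inj₂ ()

  reversed-antisym : ∀ a b → reversedEdge a b ≡ true → reversedEdge b a ≡ false
  reversed-antisym a b e with Edge T a b in ab
  ... | true rewrite antisym T a b ab with R (c a b) | e
  ...   | false | _ = refl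
  reversed-antisym a b e | false with Edge T b a | R (c b a) | e
  ...   | true | true | _ = refl

  reversed : Tournament n
  reversed = record
    { Edge     = reversedEdge
    ; irrefl   = reversed-irrefl
    ; complete = λ a b a≢b → reversed-complete a b (complete T a b a≢b)
    ; antisym  = reversed-antisym
    }

  recoloured : Colouring n k
  recoloured a b = if Edge T a b then c a b else c b a

  reversed-colEdge⁻ : ∀ i a b → ColEdge reversed recoloured i a b →
                      (R i ≡ false × ColEdge T c i a b) ⊎ (R i ≡ true × ColEdge T c i b a)
  reversed-colEdge⁻ i a b (e , refl) with Edge T a b in ab
  ... | true with R (c a b) | antisym T a b ab
  ...   | false | _  = inj₁ (refl , refl , refl)
  ...   | true  | ba rewrite ba with e
  ...     | ()
  reversed-colEdge⁻ i a b (e , refl) | false with Edge T b a | R (c b a) | e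
  ...   | true | true | _ = inj₂ (refl , refl , refl)

  reversed-colEdge⁺ˡ : ∀ i a b → R i ≡ false → ColEdge T c i a b → ColEdge reversed recoloured i a b
  reversed-colEdge⁺ˡ i a b Ri (ab , refl) rewrite ab | Ri = refl , refl

  reversed-colEdge⁺ʳ : ∀ i a b → R i ≡ true → ColEdge T c i b a → ColEdge reversed recoloured i a b
  reversed-colEdge⁺ʳ i a b Ri (ba , refl) rewrite ba | antisym T b a ba | Ri = refl , refl

  reversed-transitive : IsTransitiveColouring T c → IsTransitiveColouring reversed recoloured
  reversed-transitive tr i a b d ab bd
    with R i in Ri | reversed-colEdge⁻ i a b ab | reversed-colEdge⁻ i b d bd
  ... | false | inj₁ (_ , ab′) | inj₁ (_ , bd′) = reversed-colEdge⁺ˡ i a d Ri (tr i a b d ab′ bd′)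
  ... | true  | inj₂ (_ , ba′) | inj₂ (_ , db′) = reversed-colEdge⁺ʳ i a d Ri (tr i d b a db′ ba′)
  ... | false | inj₂ (() , _)   | _
  ... | true  | inj₁ (() , _)   | _

open Reversal using (reversed; recoloured; reversed-colEdge⁻; reversed-transitive)

colourSet : ∀ {k} → Fin (2 ^ k) → Fin k → Bool
colourSet j = Inverse.to 2↔Bool ∘ finToFun j

colourSet-surjective : ∀ {k} (R : Fin k → Bool) → ∃[ j ] (colourSet j ≗ R)
colourSet-surjective R = funToFin (Inverse.from 2↔Bool ∘ R) , λ i →
  trans (cong (Inverse.to 2↔Bool) (finToFun-funToFin (Inverse.from 2↔Bool ∘ R) i))
        (Inverse.strictlyInverseˡ 2↔Bool (R i))

length-concatMap-≤ : ∀ {A B : Set} (f : A → List B) {p} xs →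
                     (∀ x → length (f x) ≤ p) → length (concatMap f xs) ≤ length xs * p
length-concatMap-≤ f []       bound = ≤-refl
length-concatMap-≤ f (x ∷ xs) bound rewrite length-++ (f x) {concatMap f xs} =
  +-mono-≤ (bound x) (length-concatMap-≤ f xs bound)

module _ {n k} (T : Tournament n) (c : Colouring n k) where

  Enclosed : List (Fin n) → Fin n → Set
  Enclosed S b = ∃[ i ] ∃[ a ] ∃[ d ] (a ∈ S × d ∈ S × ColEdge T c i a b × ColEdge T c i b d)

  InEdgeFrom : List (Fin n) → Fin n → Fin k → Set
  InEdgeFrom S b i = Any (λ a → ColEdge T c i a b) S

  inEdgeFrom? : ∀ S b i → Dec (InEdgeFrom S b i)
  inEdgeFrom? S b i = any? (λ a → (Edge T a b ≟ᵇ true) ×-dec (c a b ≟ᶠ i)) S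

  enclosed-if-dominated-in-reversal :
    ∀ {S b w} (R : Fin k → Bool) → (∀ i → Reflects (InEdgeFrom S b i) (R i)) →
    w ∈ S → w ⇒[ reversed T c R ] b → Enclosed S b
  enclosed-if-dominated-in-reversal {b = b} {w} R R-reflects w∈S w⇒b
    with R i | R-reflects i | reversed-colEdge⁻ T c R i w b (w⇒b , refl)
    where i = recoloured T c R w b
  ... | true  | ofʸ into-b | inj₂ (_ , bw) =
    let a , a∈S , ab = find into-b in _ , a , w , a∈S , w∈S , ab , bw
  ... | false | ofⁿ ¬into-b | inj₁ (_ , wb) = ⊥-elim (¬into-b (lose w∈S wb))
  ... | true  | _ | inj₁ (() , _)
  ... | false | _ | inj₂ (() , _)

corollary1p5 : (k p : ℕ) → k ≥ 1 →
    (∀ (n : ℕ) (T : Tournament n) → KTransitive k T → DomAtMost T p) →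
    ∀ (n : ℕ) (T : Tournament n) (c : Colouring n k) → IsTransitiveColouring T c →
      EnclAtMost T c (2 ^ k * p)
corollary1p5 k p _ dom n T c tr = S , S-encloses , S-size
  where
  reversalDominator : (j : Fin (2 ^ k)) → DomAtMost (reversed T c (colourSet j)) p
  reversalDominator j =
    dom n (reversed T c (colourSet j))
          (recoloured T c (colourSet j) , reversed-transitive T c (colourSet j) tr)

  S : List (Fin n)
  S = concatMap (proj₁ ∘ reversalDominator) (allFin (2 ^ k))

  dominator⊆S : ∀ j {v} → v ∈ proj₁ (reversalDominator j) → v ∈ S
  dominator⊆S j v∈ = ∈-concatMap⁺ (proj₁ ∘ reversalDominator) (lose (∈-allFin j) v∈)

  S-size : length S ≤ 2 ^ k * p
  S-size = ≤-trans (length-concatMap-≤ (proj₁ ∘ reversalDominator) (allFin (2 ^ k))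
                                        (proj₂ ∘ proj₂ ∘ reversalDominator))
                   (≤-reflexive (cong (_* p) (length-tabulate {n = 2 ^ k} id)))

  S-encloses : IsEnclosure T c S
  S-encloses b b∉S =
    let j , j-realises = colourSet-surjective (λ i → does (inEdgeFrom? T c S b i))
        _ , dominates , _ = reversalDominator j
        w , w∈ , w⇒b = dominates b (b∉S ∘ dominator⊆S j)
        R-reflects i = subst (Reflects _) (sym (j-realises i)) (proof (inEdgeFrom? T c S b i))
    in enclosed-if-dominated-in-reversal T c (colourSet j) R-reflects (dominator⊆S j w∈) w⇒b
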